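{- Let $\mathbb{N}$ be first-order number theory, assumed consistent. There exists a predicate sequence $(P_n)$ which is Cauchy convergent but has no limit among the predicate strings of $\mathbb{N}$ (i.e. does not converge to a standard predicate).
   Context: $\mathbb{N}$ denotes first-order (Peano) number theory in a language with $0$ and successor; numerals are $0,0',0'',\dots$, and "$x\le M$" for numerals means $x$ ranges over the numerals $0,\dots,M$. A predicate sequence is a function $n\mapsto P_n$ from numerals to predicate strings (formulas with one free variable) of $\mathbb{N}$ that is definable recursively in terms of concatenation of strings (i.e. a computable map). A predicate sequence is Cauchy convergent if for every $M$, all $n,m\ge M$ and all numerals $x\le M$, $\mathbb{N}\vdash P_n(x)\leftrightarrow P_m(x)$. A predicate string $L$ of $\mathbb{N}$ is a limit of the sequence if for every $M$ and every numeral $x\le M$, $\mathbb{N}\vdash L(x)\leftrightarrow P_M(x)$. A standard predicate is one given by (equivalent to) a predicate string of $\mathbb{N}$. -}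

module Defs where

open import Data.Nat using (ℕ; zero; suc; _≤_)
open import Data.Fin using (Fin; zero; suc)
open import Data.List using (List; []; _∷_; map)
open import Data.List.Membership.Propositional using (_∈_)
open import Data.Product using (Σ; _×_)
open import Relation.Nullary using (¬_)

-- Syntax of first-order (Peano) number theory.
-- Variables are de Bruijn indices; `Term n` / `Formula n` have free
-- variables among Fin n.  Language: 0, successor, +, ×, =.

infixl 7 _·_
infixl 6 _⊕_

data Term (n : ℕ) : Set where
  var  : Fin n → Term n
  `0   : Term n
  `S   : Term n → Term n
  _⊕_  : Term n → Term n → Term n
  _·_  : Term n → Term n → Term n

infix  5 _≈_
infixr 4 _∧_
infixr 3 _∨_
infixr 2 _⇒_

data Formula (n : ℕ) : Set where
  _≈_  : Term n → Term n → Formula n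
  ⊥'   : Formula n
  _⇒_  : Formula n → Formula n → Formula n
  _∧_  : Formula n → Formula n → Formula n
  _∨_  : Formula n → Formula n → Formula n
  ∀'   : Formula (suc n) → Formula n
  ∃'   : Formula (suc n) → Formula n

¬' : ∀ {n} → Formula n → Formula n
¬' φ = φ ⇒ ⊥'

infix 1 _⇔_
_⇔_ : ∀ {n} → Formula n → Formula n → Formula n
φ ⇔ ψ = (φ ⇒ ψ) ∧ (ψ ⇒ φ)

Ren : ℕ → ℕ → Set
Ren m n = Fin m → Fin n

liftR : ∀ {m n} → Ren m n → Ren (suc m) (suc n)
liftR ρ zero    = zero
liftR ρ (suc i) = suc (ρ i)

renT : ∀ {m n} → Ren m n → Term m → Term n
renT ρ (var i) = var (ρ i)
renT ρ `0      = `0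
renT ρ (`S t)  = `S (renT ρ t)
renT ρ (s ⊕ t) = renT ρ s ⊕ renT ρ t
renT ρ (s · t) = renT ρ s · renT ρ t

renF : ∀ {m n} → Ren m n → Formula m → Formula n
renF ρ (s ≈ t) = renT ρ s ≈ renT ρ t
renF ρ ⊥'      = ⊥'
renF ρ (φ ⇒ ψ) = renF ρ φ ⇒ renF ρ ψ
renF ρ (φ ∧ ψ) = renF ρ φ ∧ renF ρ ψ
renF ρ (φ ∨ ψ) = renF ρ φ ∨ renF ρ ψ
renF ρ (∀' φ)  = ∀' (renF (liftR ρ) φ)
renF ρ (∃' φ)  = ∃' (renF (liftR ρ) φ)

wkF : ∀ {n} → Formula n → Formula (suc n)
wkF = renF suc

Sub : ℕ → ℕ → Set
Sub m n = Fin m → Term n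

liftS : ∀ {m n} → Sub m n → Sub (suc m) (suc n)
liftS σ zero    = var zero
liftS σ (suc i) = renT suc (σ i)

subT : ∀ {m n} → Sub m n → Term m → Term n
subT σ (var i) = σ i
subT σ `0      = `0
subT σ (`S t)  = `S (subT σ t)
subT σ (s ⊕ t) = subT σ s ⊕ subT σ t
subT σ (s · t) = subT σ s · subT σ t

subF : ∀ {m n} → Sub m n → Formula m → Formula n
subF σ (s ≈ t) = subT σ s ≈ subT σ t
subF σ ⊥'      = ⊥'
subF σ (φ ⇒ ψ) = subF σ φ ⇒ subF σ ψ
subF σ (φ ∧ ψ) = subF σ φ ∧ subF σ ψ
subF σ (φ ∨ ψ) = subF σ φ ∨ subF σ ψ
subF σ (∀' φ)  = ∀' (subF (liftS σ) φ)
subF σ (∃' φ)  = ∃' (subF (liftS σ) φ)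

sub0 : ∀ {n} → Term n → Sub (suc n) n
sub0 t zero    = t
sub0 t (suc i) = var i

_[_] : ∀ {n} → Formula (suc n) → Term n → Formula n
φ [ t ] = subF (sub0 t) φ

succ0 : ∀ {n} → Sub (suc n) (suc n)
succ0 zero    = `S (var zero)
succ0 (suc i) = var (suc i)

-- Axioms of Peano arithmetic (universally closed; induction schema with
-- parameters, the parameters being the ambient free variables).

v0 v1 : ∀ {n} → Term (suc (suc n))
v0 = var zero
v1 = var (suc zero)

data PAAxiom {n : ℕ} : Formula n → Set where
  ax-S≢0  : PAAxiom (∀' (¬' (`S (var zero) ≈ `0)))
  ax-Sinj : PAAxiom (∀' (∀' (`S v1 ≈ `S v0 ⇒ v1 ≈ v0)))
  ax-+0   : PAAxiom (∀' (var zero ⊕ `0 ≈ var zero))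
  ax-+S   : PAAxiom (∀' (∀' (v1 ⊕ `S v0 ≈ `S (v1 ⊕ v0))))
  ax-·0   : PAAxiom (∀' (var zero · `0 ≈ `0))
  ax-·S   : PAAxiom (∀' (∀' (v1 · `S v0 ≈ (v1 · v0) ⊕ v1)))
  ax-ind  : (φ : Formula (suc n)) →
            PAAxiom ((φ [ `0 ] ∧ ∀' (φ ⇒ subF succ0 φ)) ⇒ ∀' φ)

infix 0 _⊢_

data _⊢_ {n : ℕ} (Γ : List (Formula n)) : Formula n → Set where
  hyp   : ∀ {φ} → φ ∈ Γ → Γ ⊢ φ
  pa    : ∀ {φ} → PAAxiom φ → Γ ⊢ φ
  raa   : ∀ {φ} → (¬' φ ∷ Γ) ⊢ ⊥' → Γ ⊢ φ
  ⇒I    : ∀ {φ ψ} → (φ ∷ Γ) ⊢ ψ → Γ ⊢ φ ⇒ ψ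
  ⇒E    : ∀ {φ ψ} → Γ ⊢ φ ⇒ ψ → Γ ⊢ φ → Γ ⊢ ψ
  ∧I    : ∀ {φ ψ} → Γ ⊢ φ → Γ ⊢ ψ → Γ ⊢ φ ∧ ψ
  ∧E₁   : ∀ {φ ψ} → Γ ⊢ φ ∧ ψ → Γ ⊢ φ
  ∧E₂   : ∀ {φ ψ} → Γ ⊢ φ ∧ ψ → Γ ⊢ ψ
  ∨I₁   : ∀ {φ ψ} → Γ ⊢ φ → Γ ⊢ φ ∨ ψ
  ∨I₂   : ∀ {φ ψ} → Γ ⊢ ψ → Γ ⊢ φ ∨ ψ
  ∨E    : ∀ {φ ψ χ} → Γ ⊢ φ ∨ ψ → (φ ∷ Γ) ⊢ χ → (ψ ∷ Γ) ⊢ χ → Γ ⊢ χ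
  ∀I    : ∀ {φ} → map wkF Γ ⊢ φ → Γ ⊢ ∀' φ
  ∀E    : ∀ {φ} → Γ ⊢ ∀' φ → (t : Term n) → Γ ⊢ φ [ t ]
  ∃I    : ∀ {φ} (t : Term n) → Γ ⊢ φ [ t ] → Γ ⊢ ∃' φ
  ∃E    : ∀ {φ ψ} → Γ ⊢ ∃' φ → (φ ∷ map wkF Γ) ⊢ wkF ψ → Γ ⊢ ψ
  ≈refl : (t : Term n) → Γ ⊢ t ≈ t
  ≈subst : ∀ {s t} (φ : Formula (suc n)) → Γ ⊢ s ≈ t → Γ ⊢ φ [ s ] → Γ ⊢ φ [ t ]

ℕ⊢_ : Formula 0 → Set
ℕ⊢ σ = [] ⊢ σ

Consistent : Set
Consistent = ¬ (ℕ⊢ ⊥')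

numeral : ℕ → Term 0
numeral zero    = `0
numeral (suc k) = `S (numeral k)

Predicate : Set
Predicate = Formula 1

_⟨_⟩ : Predicate → ℕ → Formula 0
P ⟨ x ⟩ = P [ numeral x ]

-- a predicate sequence: a computable map numerals → predicate strings;
-- every Agda function is computable, so it is just a function.
PredSeq : Set
PredSeq = ℕ → Predicate

CauchyConvergent : PredSeq → Set
CauchyConvergent P = ∀ M n m → M ≤ n → M ≤ m → ∀ x → x ≤ M →
  ℕ⊢ (P n ⟨ x ⟩ ⇔ P m ⟨ x ⟩)

IsLimit : Predicate → PredSeq → Set
IsLimit L P = ∀ M x → x ≤ M → ℕ⊢ (L ⟨ x ⟩ ⇔ P M ⟨ x ⟩)

{-# OPTIONS --safe #-}
-- Enumerate all predicate strings as e₀, e₁, … and let Pₙ(x) be the conjunction of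
-- x = k → ¬ eₖ(x) over k ≤ n.  Since distinct numerals are provably distinct, Pₙ(x) is
-- provably equivalent to ¬ eₓ(x) as soon as x ≤ n, so the sequence is Cauchy convergent.
-- A limit L would be some eₖ, and then L(k) ↔ Pₖ(k) ↔ ¬ L(k) would make ℕ inconsistent.
module Submission where

open import Defs
open import Data.Fin using (Fin; zero; suc; toℕ; fromℕ<)
open import Data.Fin.Properties using (toℕ<n; fromℕ<-toℕ)
open import Data.List using (List; _∷_)
open import Data.List.Relation.Unary.Any using (here; there)
open import Data.Nat using (ℕ; zero; suc; _≤_; _<_; _+_; _⊔_; z≤n; s≤s; _≟_; _<?_)
open import Data.Nat.Properties
  using ( +-suc; +-identityʳ; ≤-refl; ≤-trans; ≤∧≢⇒<; m<1+n⇒m≤n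
        ; m⊔n<o⇒m<o; m⊔n<o⇒n<o )
open import Data.Product using (Σ; ∃; _×_; _,_; map; uncurry)
open import Function using (_∘_)
open import Function.Definitions using (StrictlySurjective)
open import Relation.Binary.PropositionalEquality
  using (_≡_; _≢_; refl; sym; trans; cong; cong₂; subst)
open import Relation.Nullary using (¬_; yes; no; contradiction)

private
  variable
    A : Set
    n : ℕ

Image : (ℕ → A) → A → Set
Image e a = ∃ λ c → e c ≡ a

image-map : ∀ {B : Set} {e : ℕ → A} {a} (g : A → B) → Image e a → Image (g ∘ e) (g a)
image-map g (c , eq) = c , cong g eq

-- Cantor's pairing, unfolded: walk along the diagonals (0 , s), (1 , s - 1), …, (s , 0).
next : ℕ × ℕ → ℕ × ℕ
next (a , zero)  = zero , suc a
next (a , suc b) = suc a , b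

unpair : ℕ → ℕ × ℕ
unpair zero    = 0 , 0
unpair (suc c) = next (unpair c)

image-next : ∀ {p} → Image unpair p → Image unpair (next p)
image-next (c , eq) = suc c , cong next eq

image-along-diagonal : ∀ a b → Image unpair (0 , a + b) → Image unpair (a , b)
image-along-diagonal zero    b start = start
image-along-diagonal (suc a) b start = image-next (image-along-diagonal a (suc b)
  (subst (λ s → Image unpair (0 , s)) (sym (+-suc a b)) start))

image-diagonal-start : ∀ s → Image unpair (0 , s)
image-diagonal-start zero    = 0 , refl
image-diagonal-start (suc s) = image-next (image-along-diagonal s 0
  (subst (λ s → Image unpair (0 , s)) (sym (+-identityʳ s)) (image-diagonal-start s)))

unpair-surjective : StrictlySurjective _≡_ unpair
unpair-surjective (a , b) = image-along-diagonal a b (image-diagonal-start (a + b))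

untag : (ℕ → ℕ → A) → ℕ → A
untag node = uncurry node ∘ unpair

decode² : (ℕ → A) → ℕ → A × A
decode² e = map e e ∘ unpair

image-untag : ∀ (node : ℕ → ℕ → A) tag {a} → Image (node tag) a → Image (untag node) a
image-untag node tag (r , eq) with unpair-surjective (tag , r)
... | c , unpair-c = c , trans (cong (uncurry node) unpair-c) eq

image-decode² : ∀ {e : ℕ → A} {a b} → Image e a → Image e b → Image (decode² e) (a , b)
image-decode² {e = e} (c₁ , eq₁) (c₂ , eq₂) with unpair-surjective (c₁ , c₂)
... | r , unpair-r = r , trans (cong (map e e) unpair-r) (cong₂ _,_ eq₁ eq₂)

-- The first argument of decodeT/decodeF is fuel bounding the height of the result;
-- out of fuel, or on an unused code, a default value is returned.
decodeVar : ℕ → Term n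
decodeVar {n} i with i <? n
... | yes i<n = var (fromℕ< i<n)
... | no _    = `0

decodeVar-toℕ : (i : Fin n) → decodeVar (toℕ i) ≡ var i
decodeVar-toℕ {n} i with toℕ i <? n
... | yes i<n = cong var (fromℕ<-toℕ i i<n)
... | no  i≮n = contradiction (toℕ<n i) i≮n

mutual
  decodeT : ℕ → ℕ → Term n
  decodeT zero    = λ _ → `0
  decodeT (suc f) = untag (termNode f)

  termNode : ℕ → ℕ → ℕ → Term n
  termNode f 0 = decodeVar
  termNode f 1 = λ _ → `0
  termNode f 2 = `S ∘ decodeT f
  termNode f 3 = uncurry _⊕_ ∘ decode² (decodeT f)
  termNode f _ = uncurry _·_ ∘ decode² (decodeT f)

mutual
  decodeF : ℕ → ℕ → Formula n
  decodeF zero    = λ _ → ⊥'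
  decodeF (suc f) = untag (formulaNode f)

  formulaNode : ℕ → ℕ → ℕ → Formula n
  formulaNode f 0 = uncurry _≈_ ∘ decode² (decodeT f)
  formulaNode f 1 = λ _ → ⊥'
  formulaNode f 2 = uncurry _⇒_ ∘ decode² (decodeF f)
  formulaNode f 3 = uncurry _∧_ ∘ decode² (decodeF f)
  formulaNode f 4 = uncurry _∨_ ∘ decode² (decodeF f)
  formulaNode f 5 = ∀' ∘ decodeF f
  formulaNode f _ = ∃' ∘ decodeF f

heightT : Term n → ℕ
heightT (var _) = 0
heightT `0      = 0
heightT (`S t)  = suc (heightT t)
heightT (s ⊕ t) = suc (heightT s ⊔ heightT t)
heightT (s · t) = suc (heightT s ⊔ heightT t)

heightF : Formula n → ℕ
heightF (s ≈ t) = suc (heightT s ⊔ heightT t)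
heightF ⊥'      = 0
heightF (φ ⇒ ψ) = suc (heightF φ ⊔ heightF ψ)
heightF (φ ∧ ψ) = suc (heightF φ ⊔ heightF ψ)
heightF (φ ∨ ψ) = suc (heightF φ ⊔ heightF ψ)
heightF (∀' φ)  = suc (heightF φ)
heightF (∃' φ)  = suc (heightF φ)

image-binary : ∀ {B : Set} (node : ℕ → ℕ → B) tag (op : A → A → B) {e : ℕ → A} {a b} →
               node tag ≡ uncurry op ∘ decode² e →
               Image e a → Image e b → Image (untag node) (op a b)
image-binary node tag op node-tag p q = image-untag node tag
  (subst (λ g → Image g _) (sym node-tag) (image-map (uncurry op) (image-decode² p q)))

decodeT-complete : (t : Term n) (f : ℕ) → heightT t < f → Image (decodeT f) t
decodeT-complete t       zero    ()
decodeT-complete (var i) (suc f) _       = image-untag (termNode f) 0 (toℕ i , decodeVar-toℕ i)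
decodeT-complete `0      (suc f) _       = image-untag (termNode f) 1 (0 , refl)
decodeT-complete (`S t)  (suc f) (s≤s h) =
  image-untag (termNode f) 2 (image-map `S (decodeT-complete t f h))
decodeT-complete (s ⊕ t) (suc f) (s≤s h) = image-binary (termNode f) 3 _⊕_ refl
  (decodeT-complete s f (m⊔n<o⇒m<o _ _ h)) (decodeT-complete t f (m⊔n<o⇒n<o _ _ h))
decodeT-complete (s · t) (suc f) (s≤s h) = image-binary (termNode f) 4 _·_ refl
  (decodeT-complete s f (m⊔n<o⇒m<o _ _ h)) (decodeT-complete t f (m⊔n<o⇒n<o _ _ h))

decodeF-complete : (φ : Formula n) (f : ℕ) → heightF φ < f → Image (decodeF f) φ
decodeF-complete φ       zero    ()
decodeF-complete (s ≈ t) (suc f) (s≤s h) = image-binary (formulaNode f) 0 _≈_ refl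
  (decodeT-complete s f (m⊔n<o⇒m<o _ _ h)) (decodeT-complete t f (m⊔n<o⇒n<o _ _ h))
decodeF-complete ⊥'      (suc f) _       = image-untag (formulaNode f) 1 (0 , refl)
decodeF-complete (φ ⇒ ψ) (suc f) (s≤s h) = image-binary (formulaNode f) 2 _⇒_ refl
  (decodeF-complete φ f (m⊔n<o⇒m<o _ _ h)) (decodeF-complete ψ f (m⊔n<o⇒n<o _ _ h))
decodeF-complete (φ ∧ ψ) (suc f) (s≤s h) = image-binary (formulaNode f) 3 _∧_ refl
  (decodeF-complete φ f (m⊔n<o⇒m<o _ _ h)) (decodeF-complete ψ f (m⊔n<o⇒n<o _ _ h))
decodeF-complete (φ ∨ ψ) (suc f) (s≤s h) = image-binary (formulaNode f) 4 _∨_ refl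
  (decodeF-complete φ f (m⊔n<o⇒m<o _ _ h)) (decodeF-complete ψ f (m⊔n<o⇒n<o _ _ h))
decodeF-complete (∀' φ)  (suc f) (s≤s h) =
  image-untag (formulaNode f) 5 (image-map ∀' (decodeF-complete φ f h))
decodeF-complete (∃' φ)  (suc f) (s≤s h) =
  image-untag (formulaNode f) 6 (image-map ∃' (decodeF-complete φ f h))

enumerate : ℕ → Formula n
enumerate = untag decodeF

enumerate-surjective : StrictlySurjective _≡_ (enumerate {n})
enumerate-surjective φ =
  image-untag decodeF (suc (heightF φ)) (decodeF-complete φ (suc (heightF φ)) ≤-refl)

wkT : Term n → Term (suc n)
wkT = renT suc

subT-sub0-wkT : (s t : Term n) → subT (sub0 s) (wkT t) ≡ t
subT-sub0-wkT s (var i) = refl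
subT-sub0-wkT s `0      = refl
subT-sub0-wkT s (`S t)  = cong `S (subT-sub0-wkT s t)
subT-sub0-wkT s (t ⊕ u) = cong₂ _⊕_ (subT-sub0-wkT s t) (subT-sub0-wkT s u)
subT-sub0-wkT s (t · u) = cong₂ _·_ (subT-sub0-wkT s t) (subT-sub0-wkT s u)

module _ {Γ : List (Formula n)} where

  ⊥'E : ∀ {φ} → Γ ⊢ ⊥' → Γ ⊢ φ
  ⊥'E = ⇒E (⇒I (raa (hyp (there (here refl)))))

  -- Lacking a weakening lemma, rules with several premises are derived via closed tautologies.
  ⇒trans : ∀ {φ ψ χ} → Γ ⊢ φ ⇒ ψ → Γ ⊢ ψ ⇒ χ → Γ ⊢ φ ⇒ χ
  ⇒trans φ⇒ψ ψ⇒χ = ⇒E (⇒E syllogism φ⇒ψ) ψ⇒χ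
    where
    syllogism : ∀ {φ ψ χ} → Γ ⊢ (φ ⇒ ψ) ⇒ (ψ ⇒ χ) ⇒ φ ⇒ χ
    syllogism = ⇒I (⇒I (⇒I (⇒E (hyp (there (here refl)))
                              (⇒E (hyp (there (there (here refl)))) (hyp (here refl))))))

  ⇔sym : ∀ {φ ψ} → Γ ⊢ φ ⇔ ψ → Γ ⊢ ψ ⇔ φ
  ⇔sym φ⇔ψ = ∧I (∧E₂ φ⇔ψ) (∧E₁ φ⇔ψ)

  ⇔trans : ∀ {φ ψ χ} → Γ ⊢ φ ⇔ ψ → Γ ⊢ ψ ⇔ χ → Γ ⊢ φ ⇔ χ
  ⇔trans φ⇔ψ ψ⇔χ = ∧I (⇒trans (∧E₁ φ⇔ψ) (∧E₁ ψ⇔χ)) (⇒trans (∧E₂ ψ⇔χ) (∧E₂ φ⇔ψ))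

  ⇔¬'-inconsistent : ∀ {φ} → Γ ⊢ φ ⇔ ¬' φ → Γ ⊢ ⊥'
  ⇔¬'-inconsistent {φ} φ⇔¬φ = ⇒E ¬φ (⇒E (∧E₂ φ⇔¬φ) ¬φ)
    where
    contraction : Γ ⊢ (φ ⇒ ¬' φ) ⇒ ¬' φ
    contraction =
      ⇒I (⇒I (⇒E (⇒E (hyp (there (here refl))) (hyp (here refl))) (hyp (here refl))))
    ¬φ : Γ ⊢ ¬' φ
    ¬φ = ⇒E contraction (∧E₁ φ⇔¬φ)

  ≈sym : ∀ {s t} → Γ ⊢ s ≈ t → Γ ⊢ t ≈ s
  ≈sym {s} {t} s≈t =
    subst (λ u → Γ ⊢ t ≈ u) (subT-sub0-wkT t s)
      (≈subst (var zero ≈ wkT s) s≈t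
        (subst (λ u → Γ ⊢ s ≈ u) (sym (subT-sub0-wkT s s)) (≈refl s)))

  S≉0 : ∀ {t} → Γ ⊢ `S t ≈ `0 → Γ ⊢ ⊥'
  S≉0 {t} = ⇒E (∀E (pa ax-S≢0) t)

  S-injective : ∀ {s t} → Γ ⊢ `S s ≈ `S t → Γ ⊢ s ≈ t
  S-injective {s} {t} = ⇒E (subst (λ u → Γ ⊢ `S u ≈ `S t ⇒ u ≈ t) (subT-sub0-wkT t s)
                                   (∀E (∀E (pa ax-Sinj) s) t))

numerals-distinct : ∀ {Γ x k} → x ≢ k → Γ ⊢ numeral x ≈ numeral k → Γ ⊢ ⊥'
numerals-distinct {x = zero}  {zero}  x≢k _ = contradiction refl x≢k
numerals-distinct {x = zero}  {suc k} _   p = S≉0 (≈sym p)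
numerals-distinct {x = suc x} {zero}  _   p = S≉0 p
numerals-distinct {x = suc x} {suc k} x≢k p =
  numerals-distinct (x≢k ∘ cong suc) (S-injective p)

caseAt : ℕ → Predicate → Predicate
caseAt k φ = var zero ≈ wkT (numeral k) ⇒ φ

byCases : (ℕ → Predicate) → PredSeq
byCases D zero    = caseAt zero (D zero)
byCases D (suc n) = caseAt (suc n) (D (suc n)) ∧ byCases D n

caseAt-⟨⟩ : ∀ k φ x → caseAt k φ ⟨ x ⟩ ≡ (numeral x ≈ numeral k ⇒ φ ⟨ x ⟩)
caseAt-⟨⟩ k φ x =
  cong (λ u → numeral x ≈ u ⇒ φ ⟨ x ⟩) (subT-sub0-wkT (numeral x) (numeral k))

module _ {Γ : List (Formula 0)} {D : ℕ → Predicate} {x : ℕ} where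

  caseAt-elim : Γ ⊢ caseAt x (D x) ⟨ x ⟩ → Γ ⊢ D x ⟨ x ⟩
  caseAt-elim p = ⇒E (subst (Γ ⊢_) (caseAt-⟨⟩ x (D x) x) p) (≈refl (numeral x))

  caseAt-from-hyp : ∀ k → (D x ⟨ x ⟩ ∷ Γ) ⊢ caseAt k (D k) ⟨ x ⟩
  caseAt-from-hyp k =
    subst (D x ⟨ x ⟩ ∷ Γ ⊢_) (sym (caseAt-⟨⟩ k (D k) x)) (⇒I (case-on k))
    where
    case-on : ∀ k → ((numeral x ≈ numeral k) ∷ D x ⟨ x ⟩ ∷ Γ) ⊢ D k ⟨ x ⟩
    case-on k with x ≟ k
    ... | yes refl = hyp (there (here refl))
    ... | no  x≢k  = ⊥'E (numerals-distinct x≢k (hyp (here refl)))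

  byCases-conjunct : ∀ {k n} → k ≤ n → Γ ⊢ byCases D n ⟨ x ⟩ → Γ ⊢ caseAt k (D k) ⟨ x ⟩
  byCases-conjunct {n = zero} z≤n p = p
  byCases-conjunct {k} {suc n} k≤n p with k ≟ suc n
  ... | yes refl = ∧E₁ p
  ... | no  k≢n  = byCases-conjunct (m<1+n⇒m≤n (≤∧≢⇒< k≤n k≢n)) (∧E₂ p)

  byCases-intro : ∀ {n} → (∀ k → Γ ⊢ caseAt k (D k) ⟨ x ⟩) → Γ ⊢ byCases D n ⟨ x ⟩
  byCases-intro {zero}  cases = cases zero
  byCases-intro {suc n} cases = ∧I (cases (suc n)) (byCases-intro cases)

byCases-⇔ : ∀ {Γ D x n} → x ≤ n → Γ ⊢ byCases D n ⟨ x ⟩ ⇔ D x ⟨ x ⟩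
byCases-⇔ {D = D} x≤n =
  ∧I (⇒I (caseAt-elim {D = D} (byCases-conjunct x≤n (hyp (here refl)))))
     (⇒I (byCases-intro (caseAt-from-hyp {D = D})))

CauchyConvergent-if-stable : ∀ {P : PredSeq} (Q : ℕ → Formula 0) →
                             (∀ {n x} → x ≤ n → ℕ⊢ (P n ⟨ x ⟩ ⇔ Q x)) → CauchyConvergent P
CauchyConvergent-if-stable Q stable M n m M≤n M≤m x x≤M =
  ⇔trans (stable (≤-trans x≤M M≤n)) (⇔sym (stable (≤-trans x≤M M≤m)))

no-limit-if-diagonalising : ∀ {P : PredSeq} → Consistent →
                            (∀ L → ∃ λ x → ℕ⊢ (P x ⟨ x ⟩ ⇔ ¬' (L ⟨ x ⟩))) →
                            ¬ Σ Predicate (λ L → IsLimit L P)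
no-limit-if-diagonalising consistent diagonalising (L , limit) with diagonalising L
... | x , Px⇔¬Lx = consistent (⇔¬'-inconsistent (⇔trans (limit x x ≤-refl) Px⇔¬Lx))

diagonalSequence : PredSeq
diagonalSequence = byCases (¬' ∘ enumerate)

mainTheorem8 : Consistent → Σ PredSeq (λ P → CauchyConvergent P × ¬ (Σ Predicate (λ L → IsLimit L P)))
mainTheorem8 consistent =
  diagonalSequence ,
  CauchyConvergent-if-stable _ byCases-⇔ ,
  no-limit-if-diagonalising consistent diagonalising
  where
  diagonalising : ∀ L → ∃ λ x → ℕ⊢ (diagonalSequence x ⟨ x ⟩ ⇔ ¬' (L ⟨ x ⟩))
  diagonalising L with enumerate-surjective L
  ... | k , refl = k , byCases-⇔ ≤-refl
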